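{- Let $P = \begin{bmatrix} 1 & 0 \\ 1 & 1 \end{bmatrix}$. Then $sm(m,P) = \Omega(m^{1/2})$.
   Context: A $0$-$1$ matrix $A$ contains a $0$-$1$ matrix $P$ if some submatrix of $A$ (obtained by selecting a subset of rows and a subset of columns, preserving order) either equals $P$ or can be changed into $P$ by turning some ones into zeroes; otherwise $A$ avoids $P$. For $0$-$1$ matrices $A, P$, $LSM(A,P)$ is the maximum number of ones in a $P$-avoiding $0$-$1$ matrix $B$ that is contained in $A$. $sm(m,P)$ is the minimum of $LSM(A,P)$ over all $0$-$1$ matrices $A$ with exactly $m$ ones. -}

module Defs where

open import Data.Nat using (ℕ; zero; suc; _+_; _*_; _≤_)
open import Data.Bool using (Bool; true; false; if_then_else_)
open import Data.Fin using (Fin; zero; suc) renaming (_<_ to _<ᶠ_)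
open import Data.List using (List; map; allFin)
open import Data.Nat.ListAction using (sum)
open import Data.Product using (Σ; ∃; _×_; _,_)
open import Relation.Binary.PropositionalEquality using (_≡_)
open import Relation.Nullary using (¬_)

-- A 0-1 matrix with r rows and c columns (entry i j = row i, column j; rows numbered top to bottom).
record Matrix : Set where
  constructor mat
  field
    rows  : ℕ
    cols  : ℕ
    entry : Fin rows → Fin cols → Bool
open Matrix public

ones : Matrix → ℕ
ones A = sum (map (λ i → sum (map (λ j → if entry A i j then 1 else 0) (allFin (cols A))))
                  (allFin (rows A)))

StrictlyIncreasing : ∀ {a b} → (Fin a → Fin b) → Set
StrictlyIncreasing f = ∀ i j → i <ᶠ j → f i <ᶠ f j

Contains : Matrix → Matrix → Set
Contains A P =
  Σ (Fin (rows P) → Fin (rows A)) λ f →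
  Σ (Fin (cols P) → Fin (cols A)) λ g →
  StrictlyIncreasing f × StrictlyIncreasing g ×
  (∀ i j → entry P i j ≡ true → entry A (f i) (g j) ≡ true)

Avoids : Matrix → Matrix → Set
Avoids A P = ¬ Contains A P

-- LSM(A,P) ≥ t : some P-avoiding B contained in A has at least t ones.
LSM≥ : Matrix → Matrix → ℕ → Set
LSM≥ A P t = Σ Matrix λ B → Contains A B × Avoids B P × t ≤ ones B

-- sm(m,P) ≥ t : every 0-1 matrix A with exactly m ones has LSM(A,P) ≥ t
-- (sm is the minimum of LSM(A,P) over such A).
sm≥ : ℕ → Matrix → ℕ → Set
sm≥ m P t = ∀ (A : Matrix) → ones A ≡ m → LSM≥ A P t

P₁ : Matrix
P₁ = mat 2 2 e
  where
  e : Fin 2 → Fin 2 → Bool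
  e zero zero = true
  e zero (suc zero) = false
  e (suc zero) zero = true
  e (suc zero) (suc zero) = true

-- Let R and C be the numbers of nonzero rows and columns of A, so that A has at most R·C
-- ones. Keeping only the leftmost one of every nonzero row gives a submatrix with R ones
-- and at most one one per row; it avoids P because the bottom row of P has two ones.
-- Symmetrically, the topmost one of every nonzero column gives C ones and avoids P because
-- the left column of P has two ones. Hence LSM(A,P) ≥ max(R,C) ≥ √(R·C) ≥ √m.
module Submission where

open import Defs
open import Data.Nat using (ℕ; zero; suc; _+_; _*_; _⊔_; _≤_; _<_; z≤n; s≤s)
open import Data.Nat.Properties
open import Data.Bool using (Bool; true; false; not; _∧_; _∨_; if_then_else_)
open import Data.Fin using (Fin; zero; suc; toℕ) renaming (_<_ to _<ᶠ_)
open import Data.List using (map; allFin; tabulate)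
import Data.Nat.ListAction as List
open import Data.Product using (Σ; _×_; _,_)
open import Data.Sum using (inj₁; inj₂)
open import Function using (_∘_; id)
open import Relation.Binary.PropositionalEquality
open import Relation.Nullary using (yes; no; contradiction)
open import Algebra.Properties.Semiring.Sum +-*-semiring
  using (sum; sum-syntax; ∑-comm; *-distribʳ-sum; sum-cong-≗; sum-replicate-zero)

iverson : Bool → ℕ
iverson b = if b then 1 else 0

sum-map-tabulate : ∀ {A : Set} {n} (g : Fin n → A) (f : A → ℕ) →
                   List.sum (map f (tabulate g)) ≡ sum (f ∘ g)
sum-map-tabulate {n = zero}  g f = refl
sum-map-tabulate {n = suc n} g f = cong (f (g zero) +_) (sum-map-tabulate (g ∘ suc) f)

sum-mono-≤ : ∀ {n} {f g : Fin n → ℕ} → (∀ i → f i ≤ g i) → sum f ≤ sum g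
sum-mono-≤ {zero}  f≤g = z≤n
sum-mono-≤ {suc n} f≤g = +-mono-≤ (f≤g zero) (sum-mono-≤ (f≤g ∘ suc))

anyTrue : ∀ {n} → (Fin n → Bool) → Bool
anyTrue {zero}  h = false
anyTrue {suc n} h = h zero ∨ anyTrue (h ∘ suc)

firstTrue : ∀ {n} → (Fin n → Bool) → Fin n → Bool
firstTrue h zero    = h zero
firstTrue h (suc j) = not (h zero) ∧ firstTrue (h ∘ suc) j

sum-firstTrue : ∀ {n} (h : Fin n → Bool) → ∑[ j < n ] iverson (firstTrue h j) ≡ iverson (anyTrue h)
sum-firstTrue {zero}  h = refl
sum-firstTrue {suc n} h with h zero
... | true  = cong suc (sum-replicate-zero n)
... | false = sum-firstTrue (h ∘ suc)

firstTrue⇒true : ∀ {n} (h : Fin n → Bool) j → firstTrue h j ≡ true → h j ≡ true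
firstTrue⇒true h zero    first = first
firstTrue⇒true h (suc j) first with h zero
... | false = firstTrue⇒true (h ∘ suc) j first

firstTrue-unique : ∀ {n} (h : Fin n → Bool) {j j′} →
                   firstTrue h j ≡ true → firstTrue h j′ ≡ true → j ≡ j′
firstTrue-unique h {zero}  {zero}   _     _      = refl
firstTrue-unique h {zero}  {suc j′} first first′ with h zero
... | true  = contradiction first′ λ ()
... | false = contradiction first λ ()
firstTrue-unique h {suc j} {zero}   first first′ with h zero
... | true  = contradiction first λ ()
... | false = contradiction first′ λ ()
firstTrue-unique h {suc j} {suc j′} first first′ with h zero
... | false = cong suc (firstTrue-unique (h ∘ suc) first first′)

true⇒anyTrue : ∀ {n} (h : Fin n → Bool) j → h j ≡ true → anyTrue h ≡ true
true⇒anyTrue h zero    hj rewrite hj = refl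
true⇒anyTrue h (suc j) hj with h zero
... | true  = refl
... | false = true⇒anyTrue (h ∘ suc) j hj

ones≡sum : ∀ A → ones A ≡ ∑[ i < rows A ] ∑[ j < cols A ] iverson (entry A i j)
ones≡sum A = trans (sum-map-tabulate id (λ i → List.sum (map (iverson ∘ entry A i) (allFin (cols A)))))
  (sum-cong-≗ {rows A} (λ i → sum-map-tabulate id (iverson ∘ entry A i)))

nonzeroRows : Matrix → ℕ
nonzeroRows A = ∑[ i < rows A ] iverson (anyTrue (entry A i))

nonzeroCols : Matrix → ℕ
nonzeroCols A = ∑[ j < cols A ] iverson (anyTrue (λ i → entry A i j))

ones≤nonzeroRows*nonzeroCols : ∀ A → ones A ≤ nonzeroRows A * nonzeroCols A
ones≤nonzeroRows*nonzeroCols A = begin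
  ones A                                                  ≡⟨ ones≡sum A ⟩
  ∑[ i < rows A ] ∑[ j < cols A ] iverson (entry A i j)   ≤⟨ sum-mono-≤ (λ i → sum-mono-≤ (entry≤ i)) ⟩
  ∑[ i < rows A ] ∑[ j < cols A ] (col j * row i)         ≡⟨ sum-cong-≗ (λ i → sym (*-distribʳ-sum (row i) col)) ⟩
  ∑[ i < rows A ] (nonzeroCols A * row i)                 ≡⟨ sum-cong-≗ (λ i → *-comm (nonzeroCols A) (row i)) ⟩
  ∑[ i < rows A ] (row i * nonzeroCols A)                 ≡⟨ sym (*-distribʳ-sum (nonzeroCols A) row) ⟩
  nonzeroRows A * nonzeroCols A                           ∎
  where
  open ≤-Reasoning
  row : Fin (rows A) → ℕ
  row i = iverson (anyTrue (entry A i))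
  col : Fin (cols A) → ℕ
  col j = iverson (anyTrue (λ i → entry A i j))
  entry≤ : ∀ i j → iverson (entry A i j) ≤ col j * row i
  entry≤ i j with entry A i j in Aij
  ... | false = z≤n
  ... | true rewrite true⇒anyTrue (λ i′ → entry A i′ j) i Aij | true⇒anyTrue (entry A i) j Aij = ≤-refl

contains-pointwise : ∀ A (e : Fin (rows A) → Fin (cols A) → Bool) →
                     (∀ i j → e i j ≡ true → entry A i j ≡ true) → Contains A (mat (rows A) (cols A) e)
contains-pointwise A e e⇒A = id , id , (λ _ _ → id) , (λ _ _ → id) , e⇒A

AtMostOnePerRow : Matrix → Set
AtMostOnePerRow B = ∀ i {j j′} → entry B i j ≡ true → entry B i j′ ≡ true → j ≡ j′

AtMostOnePerCol : Matrix → Set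
AtMostOnePerCol B = ∀ j {i i′} → entry B i j ≡ true → entry B i′ j ≡ true → i ≡ i′

atMostOnePerRow⇒avoids : ∀ {B P} → AtMostOnePerRow B → ∀ i {j j′} → j <ᶠ j′ →
                         entry P i j ≡ true → entry P i j′ ≡ true → Avoids B P
atMostOnePerRow⇒avoids sparse i j<j′ Pij Pij′ (f , g , _ , g-inc , P⇒B) =
  <-irrefl (cong toℕ (sparse (f i) (P⇒B i _ Pij) (P⇒B i _ Pij′))) (g-inc _ _ j<j′)

atMostOnePerCol⇒avoids : ∀ {B P} → AtMostOnePerCol B → ∀ j {i i′} → i <ᶠ i′ →
                         entry P i j ≡ true → entry P i′ j ≡ true → Avoids B P
atMostOnePerCol⇒avoids sparse j i<i′ Pij Pi′j (f , g , f-inc , _ , P⇒B) =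
  <-irrefl (cong toℕ (sparse (g j) (P⇒B _ j Pij) (P⇒B _ j Pi′j))) (f-inc _ _ i<i′)

leftmostOnes : Matrix → Matrix
leftmostOnes A = mat (rows A) (cols A) (λ i → firstTrue (entry A i))

topmostOnes : Matrix → Matrix
topmostOnes A = mat (rows A) (cols A) (λ i j → firstTrue (λ i′ → entry A i′ j) i)

ones-leftmostOnes : ∀ A → ones (leftmostOnes A) ≡ nonzeroRows A
ones-leftmostOnes A = trans (ones≡sum (leftmostOnes A)) (sum-cong-≗ (λ i → sum-firstTrue (entry A i)))

ones-topmostOnes : ∀ A → ones (topmostOnes A) ≡ nonzeroCols A
ones-topmostOnes A = begin
  ones (topmostOnes A)
    ≡⟨ ones≡sum (topmostOnes A) ⟩
  ∑[ i < rows A ] ∑[ j < cols A ] iverson (firstTrue (λ i′ → entry A i′ j) i)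
    ≡⟨ ∑-comm (λ i j → iverson (firstTrue (λ i′ → entry A i′ j) i)) ⟩
  ∑[ j < cols A ] ∑[ i < rows A ] iverson (firstTrue (λ i′ → entry A i′ j) i)
    ≡⟨ sum-cong-≗ (λ j → sum-firstTrue (λ i′ → entry A i′ j)) ⟩
  nonzeroCols A ∎
  where open ≡-Reasoning

atMostOnePerRow⇒avoids-P₁ : ∀ {B} → AtMostOnePerRow B → Avoids B P₁
atMostOnePerRow⇒avoids-P₁ {B} sparse =
  atMostOnePerRow⇒avoids {B} {P₁} sparse (suc zero) {zero} {suc zero} (s≤s z≤n) refl refl

atMostOnePerCol⇒avoids-P₁ : ∀ {B} → AtMostOnePerCol B → Avoids B P₁
atMostOnePerCol⇒avoids-P₁ {B} sparse =
  atMostOnePerCol⇒avoids {B} {P₁} sparse zero {zero} {suc zero} (s≤s z≤n) refl refl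

LSM≥-nonzeroRows : ∀ A → LSM≥ A P₁ (nonzeroRows A)
LSM≥-nonzeroRows A =
  leftmostOnes A ,
  contains-pointwise A (entry (leftmostOnes A)) (λ i → firstTrue⇒true (entry A i)) ,
  atMostOnePerRow⇒avoids-P₁ (λ i → firstTrue-unique (entry A i)) ,
  ≤-reflexive (sym (ones-leftmostOnes A))

LSM≥-nonzeroCols : ∀ A → LSM≥ A P₁ (nonzeroCols A)
LSM≥-nonzeroCols A =
  topmostOnes A ,
  contains-pointwise A (entry (topmostOnes A)) (λ i j → firstTrue⇒true (λ i′ → entry A i′ j) i) ,
  atMostOnePerCol⇒avoids-P₁ (λ j → firstTrue-unique (λ i′ → entry A i′ j)) ,
  ≤-reflexive (sym (ones-topmostOnes A))

LSM≥-mono : ∀ {A P t u} → t ≤ u → LSM≥ A P u → LSM≥ A P t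
LSM≥-mono t≤u (B , A⊇B , B∌P , u≤B) = B , A⊇B , B∌P , ≤-trans t≤u u≤B

LSM≥-⊔ : ∀ {A P t u} → LSM≥ A P t → LSM≥ A P u → LSM≥ A P (t ⊔ u)
LSM≥-⊔ {t = t} {u} lsm-t lsm-u with ⊔-sel t u
... | inj₁ t⊔u≡t rewrite t⊔u≡t = lsm-t
... | inj₂ t⊔u≡u rewrite t⊔u≡u = lsm-u

ones≤square : ∀ A → ones A ≤ (nonzeroRows A ⊔ nonzeroCols A) * (nonzeroRows A ⊔ nonzeroCols A)
ones≤square A = ≤-trans (ones≤nonzeroRows*nonzeroCols A)
  (*-mono-≤ (m≤m⊔n (nonzeroRows A) _) (m≤n⊔m _ (nonzeroCols A)))

sm≥-P₁-sqrt : ∀ m t → (∀ s → m ≤ s * s → t ≤ s) → sm≥ m P₁ t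
sm≥-P₁-sqrt m t least A ones≡m =
  LSM≥-mono {A} {P₁} (least (nonzeroRows A ⊔ nonzeroCols A) (subst (_≤ _) ones≡m (ones≤square A)))
            (LSM≥-⊔ {A} {P₁} (LSM≥-nonzeroRows A) (LSM≥-nonzeroCols A))

ceilSqrt : ∀ m → Σ ℕ λ t → m ≤ t * t × (∀ s → m ≤ s * s → t ≤ s)
ceilSqrt zero = 0 , z≤n , λ _ _ → z≤n
ceilSqrt (suc m) with ceilSqrt m
... | t , m≤t² , least with suc m ≤? t * t
...   | yes 1+m≤t² = t , 1+m≤t² , λ s 1+m≤s² → least s (≤-trans (n≤1+n m) 1+m≤s²)
...   | no 1+m≰t² = suc t , 1+m≤[1+t]² , least′
  where
  m≡t² : m ≡ t * t
  m≡t² = ≤-antisym m≤t² (≤-pred (≰⇒> 1+m≰t²))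
  1+m≤[1+t]² : suc m ≤ suc t * suc t
  1+m≤[1+t]² = s≤s (begin
    m             ≡⟨ m≡t² ⟩
    t * t         ≤⟨ *-monoʳ-≤ t (n≤1+n t) ⟩
    t * suc t     ≤⟨ m≤n+m _ t ⟩
    t + t * suc t ∎)
    where open ≤-Reasoning
  least′ : ∀ s → suc m ≤ s * s → suc t ≤ s
  least′ s 1+m≤s² = ≰⇒> λ s≤t →
    <⇒≱ 1+m≤s² (subst (s * s ≤_) (sym m≡t²) (*-mono-≤ s≤t s≤t))

mainTheorem8 : Σ ℕ λ k → Σ ℕ λ M → 0 < k ×
    (∀ m → M ≤ m → Σ ℕ λ t → m ≤ k * (t * t) × sm≥ m P₁ t)
mainTheorem8 = 1 , 0 , s≤s z≤n , bound
  where
  bound : ∀ m → 0 ≤ m → Σ ℕ λ t → m ≤ 1 * (t * t) × sm≥ m P₁ t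
  bound m _ with ceilSqrt m
  ... | t , m≤t² , least = t , subst (m ≤_) (sym (*-identityˡ (t * t))) m≤t² , sm≥-P₁-sqrt m t least
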